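{- Let $g\ge 5$. If $\mathcal{H}$ is a 3-uniform hypergraph on $n$ vertices with girth $g$, then $$|\mathcal{H}|\le \frac{1}{3}\,\mathrm{ex}(n,\{C_4,C_5,\dots,C_{g-1}\}).$$
   Context: A hypergraph has girth $g$ (in the Berge sense) if it contains no Berge-$C_i$ for $i=2,3,\dots,g-1$. For $i\ge 2$, a Berge-$C_i$ consists of distinct vertices $v_1,\dots,v_i$ and distinct hyperedges $h_1,\dots,h_i$ with $\{v_j,v_{j+1}\}\subseteq h_j$ (indices mod $i$); in particular being Berge-$C_2$-free means any two hyperedges share at most one vertex. $\mathrm{ex}(n,\{C_4,\dots,C_{g-1}\})$ is the maximum number of edges in a simple graph on $n$ vertices containing no cycle of length $4,5,\dots,g-1$ as a subgraph. -}

module Defs where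

open import Data.Nat using (ℕ; zero; suc; _≤_; _<_; _*_)
open import Data.Nat.DivMod using (_%_; m%n<n)
open import Data.Fin using (Fin; toℕ; fromℕ<)
open import Data.Fin.Subset using (Subset; _∈_; ∣_∣)
open import Data.List using (List; length; lookup)
open import Data.List.Relation.Unary.All using (All)
open import Data.List.Relation.Unary.Any using (Any)
open import Data.List.Relation.Unary.Unique.Propositional using (Unique)
open import Data.Product using (Σ; _×_; ∃)
open import Relation.Binary.PropositionalEquality using (_≡_)
open import Relation.Nullary using (¬_)
open import Function.Definitions using (Injective)

next : {k : ℕ} → Fin (suc k) → Fin (suc k)
next {k} j = fromℕ< (m%n<n (suc (toℕ j)) (suc k))

record Hypergraph3 (n : ℕ) : Set where
  field
    edges    : List (Subset n)
    distinct : Unique edges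
    uniform  : All (λ e → ∣ e ∣ ≡ 3) edges

open Hypergraph3 public

size : {n : ℕ} → Hypergraph3 n → ℕ
size H = length (edges H)

-- Berge cycle of length suc k (k ≥ 1, i.e. length ≥ 2):
-- distinct vertices v_0..v_k, distinct hyperedges h_0..h_k
-- with {v_j, v_{j+1}} ⊆ h_j (indices mod suc k).
record BergeCycle {n : ℕ} (H : Hypergraph3 n) (k : ℕ) : Set where
  field
    v     : Fin (suc k) → Fin n
    h     : Fin (suc k) → Fin (length (edges H))
    v-inj : Injective _≡_ _≡_ v
    h-inj : Injective _≡_ _≡_ h
    incl  : ∀ j → (v j ∈ lookup (edges H) (h j)) × (v (next j) ∈ lookup (edges H) (h j))

-- H has girth g: no Berge-C_i for i = 2, …, g-1  (i = suc k)
HasGirth : {n : ℕ} → Hypergraph3 n → ℕ → Set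
HasGirth H g = ∀ k → 1 ≤ k → suc k < g → ¬ BergeCycle H k

record Graph (n : ℕ) : Set where
  field
    gedges    : List (Subset n)
    gdistinct : Unique gedges
    two       : All (λ e → ∣ e ∣ ≡ 2) gedges

open Graph public

numEdges : {n : ℕ} → Graph n → ℕ
numEdges G = length (gedges G)

record Cycle {n : ℕ} (G : Graph n) (k : ℕ) : Set where
  field
    v     : Fin (suc k) → Fin n
    v-inj : Injective _≡_ _≡_ v
    adj   : ∀ j → Any (λ e → (v j ∈ e) × (v (next j) ∈ e)) (gedges G)

NoShortCycles : {n : ℕ} → ℕ → Graph n → Set
NoShortCycles g G = ∀ k → 4 ≤ suc k → suc k < g → ¬ Cycle G k

-- m = ex(n, {C_4,…,C_(g-1)}): attained, and an upper bound for all such graphs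
IsEx : ℕ → ℕ → ℕ → Set
IsEx n g m =
  (Σ (Graph n) λ G → NoShortCycles g G × numEdges G ≡ m)
  × (∀ (G : Graph n) → NoShortCycles g G → numEdges G ≤ m)

-- Girth ≥ 3 makes H linear: two hyperedges share at most one vertex.  Hence the
-- 2-shadow ∂H, the graph of all pairs inside a hyperedge, has exactly 3·|H| edges.  It remains
-- to see that ∂H has no cycle C_K with 4 ≤ K < g.  Label every edge of such a cycle by a
-- hyperedge containing it.  Not all labels are equal, since a hyperedge has only 3 vertices.
-- The general fact behind the proof is then: a closed walk through distinct vertices that uses
-- at least two labels contains a Berge cycle of length between 2 and K (merge consecutive steps
-- with the same label; once the first repeated label is not consecutive, the stretch between its
-- two occurrences is a Berge cycle).  That contradicts girth g.

module Submission where

open import Defs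
open import Data.Nat using (ℕ; zero; suc; _+_; _*_; _≤_; _<_; z≤n; s≤s; NonZero)
open import Data.Nat.Properties
  using ( suc-injective; ≤-refl; ≤-trans; ≤-pred; <⇒≤; <⇒≢; <⇒≱; <-trans; <-irrefl; ≤-<-trans; <-≤-trans
        ; n<1+n; m<n⇒m<1+n; m≤n⇒m≤1+n; m<1+n⇒m<n∨m≡n; m≤n⇒m<n∨m≡n; <-cmp; m≤m+n; m≤n+m
        ; +-comm; *-suc; +-monoˡ-≤; +-monoˡ-<; +-cancelʳ-≡; m≤n⇒∃[o]m+o≡n; anyUpTo? )
  renaming (_≟_ to _≟ℕ_)
open import Data.Nat.DivMod using (_%_; _mod_; n%n≡0; m<n⇒m%n≡m)
open import Data.Fin using (Fin; toℕ) renaming (zero to fzero; suc to fsuc)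
open import Data.Fin.Properties using (toℕ-injective; toℕ-fromℕ<; toℕ<n) renaming (_≟_ to _≟ᶠ_)
open import Data.Fin.Subset using (Subset; _∈_; _∉_; _⊆_; _-_; ∣_∣; Nonempty; inside; outside)
open import Data.Fin.Subset.Properties using (p─q⊆p; x∈p∧x≢y⇒x∈p-y; p─⊥≡p)
open import Data.Vec.Base using (_∷_; here; there)
open import Data.List using (List; []; _∷_; length; lookup; _++_; applyUpTo)
open import Data.List.Properties using (length-++; length-applyUpTo)
open import Data.List.Relation.Unary.All using (All; []; _∷_)
import Data.List.Relation.Unary.All as All
import Data.List.Relation.Unary.All.Properties as All
open import Data.List.Relation.Unary.Any using (Any; here; there)
import Data.List.Relation.Unary.Any as Any
open import Data.List.Relation.Unary.Any.Properties using (lookup-index)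
open import Data.List.Relation.Unary.Unique.Propositional using (Unique; []; _∷_)
import Data.List.Relation.Unary.Unique.Propositional.Properties as Unique
open import Data.List.Membership.Propositional using (find) renaming (_∈_ to _∈ₗ_)
open import Data.List.Membership.Propositional.Properties using (∈-++⁻; ∈-lookup)
open import Data.Product using (Σ; _×_; _,_; proj₁; proj₂)
open import Data.Sum using (_⊎_; inj₁; inj₂)
open import Data.Empty using (⊥; ⊥-elim)
open import Function using (_∘_)
open import Relation.Nullary using (¬_; yes; no)
open import Relation.Binary.Definitions using (DecidableEquality; tri<; tri≈; tri>)
open import Relation.Binary.PropositionalEquality
  using (_≡_; _≢_; refl; sym; trans; cong; subst; subst₂; ≢-sym; module ≡-Reasoning)

private variable
  n k : ℕ
  p : Subset n
  x y : Fin n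

∣p∣≡1+∣p-x∣ : x ∈ p → ∣ p ∣ ≡ suc ∣ p - x ∣
∣p∣≡1+∣p-x∣ {p = inside  ∷ q} here        = cong suc (sym (cong ∣_∣ (p─⊥≡p q)))
∣p∣≡1+∣p-x∣ {p = inside  ∷ q} (there x∈q) = cong suc (∣p∣≡1+∣p-x∣ x∈q)
∣p∣≡1+∣p-x∣ {p = outside ∷ q} (there x∈q) = ∣p∣≡1+∣p-x∣ x∈q

x∉p-x : x ∉ p - x
x∉p-x {x = fzero} {p = _ ∷ _} ()
x∉p-x {x = fsuc x} {p = _ ∷ _} (there x∈p-x) = x∉p-x x∈p-x

p-x≢p-y : x ∈ p → x ≢ y → p - x ≢ p - y
p-x≢p-y x∈p x≢y p-x≡p-y = x∉p-x (subst (_ ∈_) (sym p-x≡p-y) (x∈p∧x≢y⇒x∈p-y x∈p x≢y))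

member : (p : Subset n) → 0 < ∣ p ∣ → Nonempty p
member (inside ∷ p) _ = fzero , here
member (outside ∷ p) 0<∣p∣ with member p 0<∣p∣
... | x , x∈p = fsuc x , there x∈p

choose : ∣ p ∣ ≡ suc k → Σ (Fin n) λ x → x ∈ p × ∣ p - x ∣ ≡ k
choose {p = p} ∣p∣≡1+k with member p (subst (0 <_) (sym ∣p∣≡1+k) (s≤s z≤n))
... | x , x∈p = x , x∈p , suc-injective (trans (sym (∣p∣≡1+∣p-x∣ x∈p)) ∣p∣≡1+k)

distinct≤∣p∣ : {xs : List (Fin n)} → Unique xs → All (_∈ p) xs → length xs ≤ ∣ p ∣
distinct≤∣p∣ [] [] = z≤n
distinct≤∣p∣ {p = p} {x ∷ xs} (x∉xs ∷ xs-unique) (x∈p ∷ xs⊆p) =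
  subst (suc _ ≤_) (sym (∣p∣≡1+∣p-x∣ x∈p))
    (s≤s (distinct≤∣p∣ xs-unique (All.zipWith remain (x∉xs , xs⊆p))))
  where
  remain : ∀ {y} → x ≢ y × y ∈ p → y ∈ p - x
  remain (x≢y , y∈p) = x∈p∧x≢y⇒x∈p-y y∈p (≢-sym x≢y)

record ThreeMembers (e : Subset n) : Set where
  field
    a b c : Fin n
    a∈e : a ∈ e
    b∈e : b ∈ e
    c∈e : c ∈ e
    a≢b : a ≢ b
    a≢c : a ≢ c
    b≢c : b ≢ c

threeMembers : {e : Subset n} → ∣ e ∣ ≡ 3 → ThreeMembers e
threeMembers {e = e} ∣e∣≡3 with choose ∣e∣≡3
... | a , a∈e , ∣e-a∣≡2 with choose ∣e-a∣≡2
... | b , b∈e-a , ∣e-a-b∣≡1 with choose ∣e-a-b∣≡1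
... | c , c∈e-a-b , _ = record
  { a = a ; b = b ; c = c
  ; a∈e = a∈e ; b∈e = b∈e ; c∈e = c∈e
  ; a≢b = λ a≡b → x∉p-x (subst (_∈ e - a) (sym a≡b) b∈e-a)
  ; a≢c = λ a≡c → x∉p-x (subst (_∈ e - a) (sym a≡c) c∈e-a)
  ; b≢c = λ b≡c → x∉p-x (subst (_∈ e - a - b) (sym b≡c) c∈e-a-b)
  }
  where
  b∈e : b ∈ e
  b∈e = p─q⊆p e _ b∈e-a
  c∈e-a : c ∈ e - a
  c∈e-a = p─q⊆p (e - a) _ c∈e-a-b
  c∈e : c ∈ e
  c∈e = p─q⊆p e _ c∈e-a

record HasPair (p : Subset n) : Set where
  constructor pair
  field
    {u v} : Fin n
    u≢v : u ≢ v
    u∈p : u ∈ p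
    v∈p : v ∈ p

triangle : (e : Subset n) → ∣ e ∣ ≡ 3 → List (Subset n)
triangle e ∣e∣≡3 = (e - a) ∷ (e - b) ∷ (e - c) ∷ []
  where open ThreeMembers (threeMembers {e = e} ∣e∣≡3)

module _ (e : Subset n) (∣e∣≡3 : ∣ e ∣ ≡ 3) where
  open ThreeMembers (threeMembers {e = e} ∣e∣≡3)

  triangle-size : All (λ p → ∣ p ∣ ≡ 2) (triangle e ∣e∣≡3)
  triangle-size = ∣e-x∣≡2 a∈e ∷ ∣e-x∣≡2 b∈e ∷ ∣e-x∣≡2 c∈e ∷ []
    where
    ∣e-x∣≡2 : ∀ {x} → x ∈ e → ∣ e - x ∣ ≡ 2
    ∣e-x∣≡2 x∈e = suc-injective (trans (sym (∣p∣≡1+∣p-x∣ x∈e)) ∣e∣≡3)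

  triangle-⊆ : All (_⊆ e) (triangle e ∣e∣≡3)
  triangle-⊆ = p─q⊆p e _ ∷ p─q⊆p e _ ∷ p─q⊆p e _ ∷ []

  triangle-pairs : All HasPair (triangle e ∣e∣≡3)
  triangle-pairs =
      pair b≢c (x∈p∧x≢y⇒x∈p-y b∈e (≢-sym a≢b)) (x∈p∧x≢y⇒x∈p-y c∈e (≢-sym a≢c))
    ∷ pair a≢c (x∈p∧x≢y⇒x∈p-y a∈e a≢b) (x∈p∧x≢y⇒x∈p-y c∈e (≢-sym b≢c))
    ∷ pair a≢b (x∈p∧x≢y⇒x∈p-y a∈e a≢c) (x∈p∧x≢y⇒x∈p-y b∈e b≢c)
    ∷ []

  triangle-unique : Unique (triangle e ∣e∣≡3)
  triangle-unique =
      (p-x≢p-y a∈e a≢b ∷ p-x≢p-y a∈e a≢c ∷ [])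
    ∷ (p-x≢p-y b∈e b≢c ∷ [])
    ∷ []
    ∷ []

Linear : List (Subset n) → Set
Linear {n} es = ∀ {e f} → e ∈ₗ es → f ∈ₗ es → e ≢ f →
  ∀ {u v : Fin n} → u ≢ v → u ∈ e → v ∈ e → u ∈ f → v ∈ f → ⊥

Uniform3 : List (Subset n) → Set
Uniform3 = All (λ e → ∣ e ∣ ≡ 3)

shadowEdges : (es : List (Subset n)) → Uniform3 es → List (Subset n)
shadowEdges []       []         = []
shadowEdges (e ∷ es) (h ∷ hs) = triangle e h ++ shadowEdges es hs

length-shadowEdges : ∀ {es : List (Subset n)} (hs : Uniform3 es) →
  length (shadowEdges es hs) ≡ 3 * length es
length-shadowEdges [] = refl
length-shadowEdges {es = e ∷ es} (h ∷ hs) =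
  begin
    length (triangle e h ++ shadowEdges es hs) ≡⟨ length-++ (triangle e h) {shadowEdges es hs} ⟩
    3 + length (shadowEdges es hs)             ≡⟨ cong (3 +_) (length-shadowEdges hs) ⟩
    3 + 3 * length es                          ≡⟨ *-suc 3 (length es) ⟨
    3 * suc (length es)                        ∎
  where open ≡-Reasoning

shadowEdges-size : ∀ {es : List (Subset n)} (hs : Uniform3 es) →
  All (λ p → ∣ p ∣ ≡ 2) (shadowEdges es hs)
shadowEdges-size [] = []
shadowEdges-size {es = e ∷ _} (h ∷ hs) = All.++⁺ (triangle-size e h) (shadowEdges-size hs)

shadowEdges-⊆ : ∀ {es : List (Subset n)} {hs : Uniform3 es} {p} →
  p ∈ₗ shadowEdges es hs → Any (p ⊆_) es
shadowEdges-⊆ {es = e ∷ _} {h ∷ _} p∈ with ∈-++⁻ (triangle e h) p∈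
... | inj₁ p∈triangle = here (All.lookup (triangle-⊆ e h) p∈triangle)
... | inj₂ p∈rest     = there (shadowEdges-⊆ p∈rest)

-- In a linear hypergraph different hyperedges have no common 2-subset, so the shadow has no repeated edge.
shadowEdges-unique : ∀ {es : List (Subset n)} (hs : Uniform3 es) →
  Unique es → Linear es → Unique (shadowEdges es hs)
shadowEdges-unique [] [] _ = []
shadowEdges-unique {es = e ∷ es} (h ∷ hs) (e∉es ∷ es-unique) linear =
  Unique.++⁺ (triangle-unique e h)
             (shadowEdges-unique hs es-unique (λ f∈es f′∈es → linear (there f∈es) (there f′∈es)))
             disjoint
  where
  disjoint : ∀ {p} → ¬ (p ∈ₗ triangle e h × p ∈ₗ shadowEdges es hs)
  disjoint {p} (p∈triangle , p∈rest) with All.lookup (triangle-pairs e h) p∈triangle | find (shadowEdges-⊆ p∈rest)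
  ... | pair u≢v u∈p v∈p | f , f∈es , p⊆f =
    linear (here refl) (there f∈es) (All.lookup e∉es f∈es) u≢v (p⊆e u∈p) (p⊆e v∈p) (p⊆f u∈p) (p⊆f v∈p)
    where
    p⊆e : p ⊆ e
    p⊆e = All.lookup (triangle-⊆ e h) p∈triangle

InjectiveBelow : {A : Set} → ℕ → (ℕ → A) → Set
InjectiveBelow K f = ∀ {i j} → i < K → j < K → f i ≡ f j → i ≡ j

-- skip i enumerates ℕ ∖ {i} in increasing order.
skip : ℕ → ℕ → ℕ
skip zero    s       = suc s
skip (suc i) zero    = zero
skip (suc i) (suc s) = suc (skip i s)

skip-< : ∀ {i s} → s < i → skip i s ≡ s
skip-< {suc i} {zero}  _         = refl
skip-< {suc i} {suc s} (s≤s s<i) = cong suc (skip-< s<i)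

skip-≥ : ∀ {i s} → i ≤ s → skip i s ≡ suc s
skip-≥ {zero}          _         = refl
skip-≥ {suc i} {suc s} (s≤s i≤s) = cong suc (skip-≥ i≤s)

skip-≤ : ∀ i s → skip i s ≤ suc s
skip-≤ zero    s       = ≤-refl
skip-≤ (suc i) zero    = z≤n
skip-≤ (suc i) (suc s) = s≤s (skip-≤ i s)

skip-injective : ∀ i {s t} → skip i s ≡ skip i t → s ≡ t
skip-injective zero    {s}     {t}     eq = suc-injective eq
skip-injective (suc i) {zero}  {zero}  _  = refl
skip-injective (suc i) {suc s} {suc t} eq = cong suc (skip-injective i (suc-injective eq))

skip-suc : ∀ {i s} → suc s ≢ i → skip i (suc s) ≡ suc (skip i s)
skip-suc {zero}                 _   = refl
skip-suc {suc zero}    {zero}   1≢1 = ⊥-elim (1≢1 refl)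
skip-suc {suc (suc i)} {zero}   _   = refl
skip-suc {suc i}       {suc s}  ne  = cong suc (skip-suc (ne ∘ cong suc))

module ClosedWalks {V L : Set} (Incident : V → L → Set) (_≟_ : DecidableEquality L) where

  record Walk (K : ℕ) : Set where
    field
      vertex           : ℕ → V
      label            : ℕ → L
      closed           : vertex K ≡ vertex 0
      vertex-injective : InjectiveBelow K vertex
      step             : ∀ {t} → t < K → Incident (vertex t) (label t) × Incident (vertex (suc t)) (label t)

  open Walk

  Monochromatic : ∀ {K} → Walk K → Set
  Monochromatic {K} W = ∀ {t} → t < K → label W t ≡ label W 0

  BergeWalk : ℕ → Set
  BergeWalk K = Σ (Walk K) λ W → InjectiveBelow K (label W)

  periodic : ∀ {k s} (W : Walk (suc k)) → s ≤ suc k → vertex W (s % suc k) ≡ vertex W s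
  periodic {k} W s≤1+k with m≤n⇒m<n∨m≡n s≤1+k
  ... | inj₁ s<1+k = cong (vertex W) (m<n⇒m%n≡m s<1+k)
  ... | inj₂ refl  = trans (cong (vertex W) (n%n≡0 (suc k))) (sym (closed W))

  two≤length : ∀ {K} (W : Walk K) → ¬ Monochromatic W → 2 ≤ K
  two≤length {zero}        W notMono = ⊥-elim (notMono λ ())
  two≤length {suc zero}    W notMono = ⊥-elim (notMono λ { {zero} _ → refl ; {suc _} (s≤s ()) })
  two≤length {suc (suc K)} W _       = s≤s (s≤s z≤n)

  record Repeat (K : ℕ) (f : ℕ → L) : Set where
    constructor repeat
    field
      start gap        : ℕ
      within           : suc gap + start < K
      same             : f (suc gap + start) ≡ f start
      injective-before : InjectiveBelow (suc gap + start) f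

  firstRepeat : ∀ K (f : ℕ → L) → InjectiveBelow K f ⊎ Repeat K f
  firstRepeat zero    f = inj₁ λ ()
  firstRepeat (suc K) f with firstRepeat K f
  ... | inj₂ (repeat t d within same injective) = inj₂ (repeat t d (m<n⇒m<1+n within) same injective)
  ... | inj₁ injective with anyUpTo? (λ t → f t ≟ f K) K
  ...   | no none = inj₁ extended
    where
    extended : InjectiveBelow (suc K) f
    extended {i} {j} i<1+K j<1+K fi≡fj with m<1+n⇒m<n∨m≡n i<1+K | m<1+n⇒m<n∨m≡n j<1+K
    ... | inj₁ i<K  | inj₁ j<K  = injective i<K j<K fi≡fj
    ... | inj₂ refl | inj₂ refl = refl
    ... | inj₁ i<K  | inj₂ refl = ⊥-elim (none (i , i<K , fi≡fj))
    ... | inj₂ refl | inj₁ j<K  = ⊥-elim (none (j , j<K , sym fi≡fj))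
  ...   | yes (t , t<K , ft≡fK) with m≤n⇒∃[o]m+o≡n t<K
  ...     | d , 1+t+d≡K with trans (cong suc (+-comm d t)) 1+t+d≡K
  ...       | refl = inj₂ (repeat t d ≤-refl (sym ft≡fK) injective)

  module _ {K : ℕ} (W : Walk K) where

    -- Between the two occurrences of a first repeated label lies a Berge walk: with
    -- D = gap + 1, it visits vertex (D + t), vertex (1 + t), …, vertex (D - 1 + t) using labels t, …, D - 1 + t.
    segment : (r : Repeat K (label W)) → BergeWalk (suc (Repeat.gap r))
    segment (repeat t d within same injective-before) = walk , label-injective
      where
      D = suc d

      index : ℕ → ℕ
      index zero    = D + t
      index (suc s) = suc s + t

      index-< : ∀ {s} → s ≤ D → index s < K
      index-< {zero}  _   = within
      index-< {suc s} s≤D = ≤-<-trans (+-monoˡ-≤ t s≤D) within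

      index-injective : InjectiveBelow D index
      index-injective {zero}  {zero}  _   _   _  = refl
      index-injective {zero}  {suc j} _   j<D eq = ⊥-elim (<-irrefl (sym (+-cancelʳ-≡ t D (suc j) eq)) j<D)
      index-injective {suc i} {zero}  i<D _   eq = ⊥-elim (<-irrefl (sym (+-cancelʳ-≡ t D (suc i) (sym eq))) i<D)
      index-injective {suc i} {suc j} _   _   eq = +-cancelʳ-≡ t (suc i) (suc j) eq

      t<K : t < K
      t<K = ≤-<-trans (m≤n+m t D) within

      walk : Walk D
      walk = record
        { vertex           = vertex W ∘ index
        ; label            = λ s → label W (s + t)
        ; closed           = refl
        ; vertex-injective = λ i<D j<D eq →
            index-injective i<D j<D (vertex-injective W (index-< (<⇒≤ i<D)) (index-< (<⇒≤ j<D)) eq)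
        ; step             = steps
        }
        where
        steps : ∀ {s} → s < D →
          Incident (vertex W (index s)) (label W (s + t)) × Incident (vertex W (index (suc s))) (label W (s + t))
        steps {zero}  _   = subst (Incident _) same (proj₁ (step W within)) , proj₂ (step W t<K)
        steps {suc s} s<D = step W (index-< (<⇒≤ s<D))

      label-injective : InjectiveBelow D (λ s → label W (s + t))
      label-injective {i} {j} i<D j<D eq =
        +-cancelʳ-≡ t i j (injective-before (+-monoˡ-< t i<D) (+-monoˡ-< t j<D) eq)

  module _ {K : ℕ} (W : Walk (suc K)) {t : ℕ} (t<K : t < K) (same : label W (suc t) ≡ label W t) where

    -- Two consecutive steps inside the same label merge into one: drop vertex (1 + t).
    contract : Walk K
    contract = record
      { vertex           = vertex W ∘ skip (suc t)
      ; label            = label W ∘ skip (suc t)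
      ; closed           = trans (cong (vertex W) (skip-≥ t<K)) (closed W)
      ; vertex-injective = λ {i} {j} i<K j<K eq →
          skip-injective (suc t) (vertex-injective W (in-range i<K) (in-range j<K) eq)
      ; step             = steps
      }
      where
      in-range : ∀ {s} → s < K → skip (suc t) s < suc K
      in-range {s} s<K = ≤-<-trans (skip-≤ (suc t) s) (s≤s s<K)

      t≡skip : skip (suc t) t ≡ t
      t≡skip = skip-< (n<1+n t)

      -- Step t of the contracted walk is steps t and t + 1 of W; every other step is a step of W.
      steps : ∀ {s} → s < K →
        Incident (vertex W (skip (suc t) s)) (label W (skip (suc t) s)) ×
        Incident (vertex W (skip (suc t) (suc s))) (label W (skip (suc t) s))
      steps {s} s<K with s ≟ℕ t
      ... | no s≢t = proj₁ (step W (in-range s<K)) ,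
                     subst (λ u → Incident (vertex W u) (label W (skip (suc t) s)))
                           (sym (skip-suc (s≢t ∘ suc-injective))) (proj₂ (step W (in-range s<K)))
      ... | yes refl =
        subst (λ u → Incident (vertex W u) (label W u)) (sym t≡skip) (proj₁ (step W (m<n⇒m<1+n t<K))) ,
        subst₂ (λ u u′ → Incident (vertex W u) (label W u′)) (sym (skip-≥ ≤-refl)) (sym t≡skip)
               (subst (Incident _) same (proj₂ (step W (s≤s t<K))))

    label-before : Monochromatic contract → ∀ {s} → s < suc t → label W s ≡ label W 0
    label-before mono {s} s<1+t = trans (cong (label W) (sym (skip-< s<1+t))) (mono (<-≤-trans s<1+t t<K))

    -- Contracting keeps the set of labels, so a walk with two labels stays one.
    contract-monochromatic : Monochromatic contract → Monochromatic W
    contract-monochromatic mono {s} s<1+K with <-cmp s (suc t)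
    ... | tri< s<1+t _ _       = label-before mono s<1+t
    ... | tri≈ _ refl _        = trans same (label-before mono (n<1+n t))
    ... | tri> _ _ (s≤s 1+t≤s) = trans (cong (label W) (sym (skip-≥ 1+t≤s))) (mono (≤-pred s<1+K))

  -- A closed walk using two different labels contains a Berge walk of length between 2 and its own:
  -- repeatedly merge consecutive steps with equal labels until the first repeated label encloses
  -- a segment of at least two steps (or no label repeats at all).
  bergeSubwalk : ∀ {K} (W : Walk K) → ¬ Monochromatic W → Σ ℕ λ K′ → 2 ≤ K′ × K′ ≤ K × BergeWalk K′
  bergeSubwalk {zero}  W notMono = ⊥-elim (notMono λ ())
  bergeSubwalk {suc K} W notMono with firstRepeat (suc K) (label W)
  ... | inj₁ injective = suc K , two≤length W notMono , ≤-refl , W , injective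
  ... | inj₂ r@(repeat t (suc d) within _ _) =
    suc (suc d) , s≤s (s≤s z≤n) , ≤-trans (m≤m+n (suc (suc d)) t) (<⇒≤ within) , segment W r
  ... | inj₂ (repeat t zero within same _)
    with bergeSubwalk (contract W (≤-pred within) same) (notMono ∘ contract-monochromatic W (≤-pred within) same)
  ...   | K′ , 2≤K′ , K′≤K , B = K′ , 2≤K′ , m≤n⇒m≤1+n K′≤K , B

toℕ-mod : ∀ {t K} .{{_ : NonZero K}} → t < K → toℕ (t mod K) ≡ t
toℕ-mod t<K = trans (toℕ-fromℕ< _) (m<n⇒m%n≡m t<K)

module Shadow {n : ℕ} (H : Hypergraph3 n) where

  E : Fin (size H) → Subset n
  E = lookup (edges H)

  open ClosedWalks (λ v i → v ∈ E i) _≟ᶠ_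
  open Walk

  bergeCycle : ∀ {k} → BergeWalk (suc k) → BergeCycle H k
  bergeCycle {k} (W , label-injective) = record
    { v     = λ j → vertex W (toℕ j)
    ; h     = λ j → label W (toℕ j)
    ; v-inj = λ eq → toℕ-injective (vertex-injective W (toℕ<n _) (toℕ<n _) eq)
    ; h-inj = λ eq → toℕ-injective (label-injective (toℕ<n _) (toℕ<n _) eq)
    ; incl  = λ j → proj₁ (step W (toℕ<n j)) ,
        subst (_∈ E (label W (toℕ j)))
              (sym (trans (cong (vertex W) (toℕ-fromℕ< _)) (periodic W (toℕ<n j))))
              (proj₂ (step W (toℕ<n j)))
    }

  bergeDigon : ∀ {i j u v} → i ≢ j → u ≢ v → u ∈ E i → v ∈ E i → u ∈ E j → v ∈ E j → BergeCycle H 1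
  bergeDigon {i} {j} {u} {v} i≢j u≢v u∈i v∈i u∈j v∈j = record
    { v = vertices ; h = hyperedges ; v-inj = vertices-inj ; h-inj = hyperedges-inj ; incl = incl }
    where
    vertices : Fin 2 → Fin n
    vertices fzero    = u
    vertices (fsuc _) = v
    hyperedges : Fin 2 → Fin (size H)
    hyperedges fzero    = i
    hyperedges (fsuc _) = j
    vertices-inj : ∀ {x y} → vertices x ≡ vertices y → x ≡ y
    vertices-inj {fzero}      {fzero}      _  = refl
    vertices-inj {fzero}      {fsuc fzero} eq = ⊥-elim (u≢v eq)
    vertices-inj {fsuc fzero} {fzero}      eq = ⊥-elim (u≢v (sym eq))
    vertices-inj {fsuc fzero} {fsuc fzero} _  = refl
    hyperedges-inj : ∀ {x y} → hyperedges x ≡ hyperedges y → x ≡ y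
    hyperedges-inj {fzero}      {fzero}      _  = refl
    hyperedges-inj {fzero}      {fsuc fzero} eq = ⊥-elim (i≢j eq)
    hyperedges-inj {fsuc fzero} {fzero}      eq = ⊥-elim (i≢j (sym eq))
    hyperedges-inj {fsuc fzero} {fsuc fzero} _  = refl
    incl : ∀ x → (vertices x ∈ E (hyperedges x)) × (vertices (next x) ∈ E (hyperedges x))
    incl fzero        = u∈i , v∈i
    incl (fsuc fzero) = v∈j , u∈j

  girth⇒linear : ∀ {g} → HasGirth H g → 2 < g → Linear (edges H)
  girth⇒linear girth 2<g e∈H f∈H e≢f u≢v u∈e v∈e u∈f v∈f =
    girth 1 ≤-refl 2<g (bergeDigon i≢j u≢v (into e∈H u∈e) (into e∈H v∈e) (into f∈H u∈f) (into f∈H v∈f))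
    where
    into : ∀ {e x} (e∈H : e ∈ₗ edges H) → x ∈ e → x ∈ E (Any.index e∈H)
    into e∈H = subst (_ ∈_) (lookup-index e∈H)
    i≢j : Any.index e∈H ≢ Any.index f∈H
    i≢j i≡j = e≢f (trans (lookup-index e∈H) (trans (cong E i≡j) (sym (lookup-index f∈H))))

  shadow : Linear (edges H) → Graph n
  shadow linear = record
    { gedges    = shadowEdges (edges H) (uniform H)
    ; gdistinct = shadowEdges-unique (uniform H) (distinct H) linear
    ; two       = shadowEdges-size (uniform H)
    }

  commonEdge : ∀ {u v} → Any (λ p → u ∈ p × v ∈ p) (shadowEdges (edges H) (uniform H)) →
    Σ (Fin (size H)) λ i → u ∈ E i × v ∈ E i
  commonEdge adjacent with find adjacent
  ... | p , p∈shadow , u∈p , v∈p =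
    Any.index p⊆e , lookup-index p⊆e u∈p , lookup-index p⊆e v∈p
    where
    p⊆e : Any (p ⊆_) (edges H)
    p⊆e = shadowEdges-⊆ {hs = uniform H} p∈shadow

  cycleWalk : ∀ {k} (linear : Linear (edges H)) → Cycle (shadow linear) k → Walk (suc k)
  cycleWalk {k} linear C = record
    { vertex           = λ t → Cycle.v C (t mod suc k)
    ; label            = λ t → proj₁ (covering t)
    ; closed           = cong (Cycle.v C) (toℕ-injective (trans (toℕ-fromℕ< _) (n%n≡0 (suc k))))
    ; vertex-injective = λ i<K j<K eq →
        trans (sym (toℕ-mod i<K)) (trans (cong toℕ (Cycle.v-inj C eq)) (toℕ-mod j<K))
    ; step             = λ {t} t<K → proj₁ (proj₂ (covering t)) ,
        subst (λ x → Cycle.v C x ∈ E (proj₁ (covering t))) (next-mod t<K) (proj₂ (proj₂ (covering t)))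
    }
    where
    covering : ∀ t → Σ (Fin (size H)) λ i → Cycle.v C (t mod suc k) ∈ E i × Cycle.v C (next (t mod suc k)) ∈ E i
    covering t = commonEdge (Cycle.adj C (t mod suc k))
    next-mod : ∀ {t} → t < suc k → next (t mod suc k) ≡ suc t mod suc k
    next-mod {t} t<K = toℕ-injective (begin
      toℕ (next (t mod suc k))        ≡⟨ toℕ-fromℕ< _ ⟩
      suc (toℕ (t mod suc k)) % suc k ≡⟨ cong (λ x → suc x % suc k) (toℕ-mod t<K) ⟩
      suc t % suc k                   ≡⟨ toℕ-fromℕ< _ ⟨
      toℕ (suc t mod suc k)           ∎)
      where open ≡-Reasoning

  monochromatic≤3 : ∀ {K} (W : Walk K) → Monochromatic W → K ≤ 3
  monochromatic≤3 {K} W mono =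
    subst₂ _≤_ (length-applyUpTo (vertex W) K) (All.lookup (uniform H) (∈-lookup (label W 0)))
      (distinct≤∣p∣ (Unique.applyUpTo⁺₁ (vertex W) K vertices-differ) (All.applyUpTo⁺₁ (vertex W) K inside-e))
    where
    vertices-differ : ∀ {i j} → i < j → j < K → vertex W i ≢ vertex W j
    vertices-differ i<j j<K eq = <⇒≢ i<j (vertex-injective W (<-trans i<j j<K) j<K eq)
    inside-e : ∀ {t} → t < K → vertex W t ∈ E (label W 0)
    inside-e t<K = subst (λ i → vertex W _ ∈ E i) (mono t<K) (proj₁ (step W t<K))

  -- Girth g: the shadow has no cycle C_K with 4 ≤ K < g.  Its hyperedge labels are not all equal
  -- (a hyperedge has only 3 vertices), so it contains a Berge cycle of length between 2 and K.
  shadow-noShortCycles : ∀ {g} → HasGirth H g → (linear : Linear (edges H)) → NoShortCycles g (shadow linear)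
  shadow-noShortCycles girth linear k 4≤K K<g C
    with bergeSubwalk (cycleWalk linear C) (λ mono → <⇒≱ 4≤K (monochromatic≤3 (cycleWalk linear C) mono))
  ... | suc k′ , s≤s 1≤k′ , K′≤K , B = girth k′ 1≤k′ (≤-<-trans K′≤K K<g) (bergeCycle B)

-- The 2-shadow of H is a simple graph without C₄, …, C_(g-1) having 3·|H| edges.
proposition2 : (g n : ℕ) → 5 ≤ g → (H : Hypergraph3 n) → HasGirth H g →
    (m : ℕ) → IsEx n g m → 3 * size H ≤ m
proposition2 g n 5≤g H girth m (_ , ex-bound) =
  subst (_≤ m) (length-shadowEdges (uniform H))
    (ex-bound (shadow linear) (shadow-noShortCycles girth linear))
  where
  open Shadow H
  linear : Linear (edges H)
  linear = girth⇒linear girth (≤-trans (s≤s (s≤s (s≤s z≤n))) 5≤g)
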